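{- Let $T:\mathbf{Set}\to\mathbf{Set}$ be a monad with multiplication $\mu$, equipped with a natural transformation $0:\underline{1}\to T$. If $T\emptyset\cong1$, then the axiom $\mathtt{p\,;\,0}=\mathtt{0}$ holds, i.e. for every set $X$ and every map $p:X\to TX$, \[ \mu_X\circ T(0_X\circ!_X)\circ p=0_X\circ!_X . \]
   Context: $\underline{1}$ is the constant functor with value a one-element set $1$, and $!_X:X\to1$ is the unique map. The constant $\mathtt{0}$ is interpreted at $X$ as $0_X\circ!_X:X\to TX$ and $\mathtt{p\,;\,q}$ as the Kleisli composite $\mu_X\circ T[\![\mathtt q]\!]\circ[\![\mathtt p]\!]$. -}

module Defs where

open import Data.Unit using (⊤; tt)
open import Function using (_∘_; id)
open import Relation.Binary.PropositionalEquality using (_≡_)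

-- Equalities of maps in Set are stated pointwise (extensionally).
record Monad : Set₁ where
  field
    T      : Set → Set
    map    : {X Y : Set} → (X → Y) → T X → T Y
    map-cong : {X Y : Set} {f g : X → Y} → (∀ x → f x ≡ g x) → ∀ t → map f t ≡ map g t
    map-id   : {X : Set} (t : T X) → map id t ≡ t
    map-∘    : {X Y Z : Set} (g : Y → Z) (f : X → Y) (t : T X) →
               map (g ∘ f) t ≡ map g (map f t)
    η : {X : Set} → X → T X
    μ : {X : Set} → T (T X) → T X
    η-natural : {X Y : Set} (f : X → Y) (x : X) → map f (η x) ≡ η (f x)
    μ-natural : {X Y : Set} (f : X → Y) (t : T (T X)) →
                map f (μ t) ≡ μ (map (map f) t)
    μ-assoc : {X : Set} (t : T (T (T X))) → μ (map μ t) ≡ μ (μ t)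
    μ-unitˡ : {X : Set} (t : T X) → μ (η t) ≡ t
    μ-unitʳ : {X : Set} (t : T X) → μ (map η t) ≡ t

-- A natural transformation 0 : 1̲ → T, where 1̲ is the constant functor at
-- the one-element set ⊤.  Its component at X is a map ⊤ → T X.
record Zero (M : Monad) : Set₁ where
  open Monad M
  field
    0[_]      : (X : Set) → ⊤ → T X
    0-natural : {X Y : Set} (f : X → Y) (u : ⊤) → map f (0[ X ] u) ≡ 0[ Y ] u

! : {X : Set} → X → ⊤
! _ = tt

-- Every value 0_X equals T(⊥-elim)(0_⊥), because 0 is natural along ⊥ → X. So
-- the Kleisli composite p ; 0 factors, via naturality of μ, as T(⊥-elim) applied
-- to an element of T ⊥. Since T ⊥ has only one element, that element is 0_⊥.
module Submission where

open import Defs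
open import Data.Empty using (⊥; ⊥-elim)
open import Data.Unit using (⊤; tt)
open import Function using (_∘_)
open import Function.Bundles using (_↔_; Injection)
open import Function.Properties.Inverse using (↔⇒↣)
open import Relation.Binary.PropositionalEquality
  using (_≡_; refl; sym; cong; module ≡-Reasoning)

↔⊤⇒irrelevant : {A : Set} → A ↔ ⊤ → (a b : A) → a ≡ b
↔⊤⇒irrelevant A↔⊤ a b = Injection.injective (↔⇒↣ A↔⊤) refl

module _ (M : Monad) (Z : Zero M) where
  open Monad M
  open Zero Z
  open ≡-Reasoning

  0-via-⊥ : (X : Set) (u : ⊤) → 0[ X ] u ≡ map ⊥-elim (0[ ⊥ ] u)
  0-via-⊥ X u = sym (0-natural ⊥-elim u)

  μ-map-0 : (X : Set) (t : T X) →
            μ (map (0[ X ] ∘ !) t) ≡ map ⊥-elim (μ (map (0[ ⊥ ] ∘ !) t))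
  μ-map-0 X t = begin
    μ (map (0[ X ] ∘ !) t)                   ≡⟨ cong μ (map-cong (0-via-⊥ X ∘ !) t) ⟩
    μ (map (map ⊥-elim ∘ 0[ ⊥ ] ∘ !) t)      ≡⟨ cong μ (map-∘ (map ⊥-elim) (0[ ⊥ ] ∘ !) t) ⟩
    μ (map (map ⊥-elim) (map (0[ ⊥ ] ∘ !) t)) ≡⟨ sym (μ-natural ⊥-elim (map (0[ ⊥ ] ∘ !) t)) ⟩
    map ⊥-elim (μ (map (0[ ⊥ ] ∘ !) t))      ∎

theorem5p8 : (M : Monad) (Z : Zero M) →
    let open Monad M in
    let open Zero Z in
    T ⊥ ↔ ⊤ →
    (X : Set) (p : X → T X) (x : X) →
      (μ ∘ map (0[ X ] ∘ !) ∘ p) x ≡ (0[ X ] ∘ !) x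
theorem5p8 M Z T⊥↔⊤ X p x = begin
  μ (map (0[ X ] ∘ !) (p x))               ≡⟨ μ-map-0 M Z X (p x) ⟩
  map ⊥-elim (μ (map (0[ ⊥ ] ∘ !) (p x)))  ≡⟨ cong (map ⊥-elim) (↔⊤⇒irrelevant T⊥↔⊤ _ _) ⟩
  map ⊥-elim (0[ ⊥ ] tt)                   ≡⟨ sym (0-via-⊥ M Z X tt) ⟩
  0[ X ] tt                                ∎
  where
  open Monad M
  open Zero Z
  open ≡-Reasoning
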